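{- For every positive integer $k$, the class $\mathcal{CW}_k$ of finite matroids of cyclic width at most $k$ is closed under duals, minors, and free products.
   Context: A flat of a matroid is cyclic if it is a (possibly empty) union of circuits; $\mathcal{Z}(M)$ is the lattice of cyclic flats of $M$ ordered by inclusion. The cyclic width of $M$ is the width of $\mathcal{Z}(M)$, i.e. the maximum size of an antichain (set of pairwise incomparable elements) in it. The free product $M\Box N$ of matroids on disjoint ground sets is the matroid on $E(M)\cup E(N)$ whose cyclic flats are exactly the sets in $\mathcal{Z}$ with ranks given by $r$, where $\mathcal{Z}'=\{X: X\in\mathcal{Z}(M), X\ne E(M)\}\cup\{E(M)\cup Y: Y\in\mathcal{Z}(N), Y\ne\emptyset\}$; $\mathcal{Z}=\mathcal{Z}'\cup\{E(M)\}$ if $M$ has no isthmuses and $N$ has no loops, and $\mathcal{Z}=\mathcal{Z}'$ otherwise; $r(X)=r_M(X)$ for $X\subseteq E(M)$ and $r(E(M)\cup Y)=r(M)+r_N(Y)$. -}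

module Defs where

open import Data.Nat using (ℕ; zero; suc; _+_; _≤_; _<_)
open import Data.Bool using (true; false)
open import Data.Fin using (Fin)
open import Data.Fin.Subset using (Subset; _∈_; _⊆_; _⊂_; ⊥; ⊤; ⁅_⁆; ∁; _∪_; _∩_; ∣_∣)
open import Data.Vec using (insertAt; _++_)
open import Data.List using (List; length; foldr)
open import Data.List.Relation.Unary.All using (All)
open import Data.List.Relation.Unary.AllPairs using (AllPairs)
open import Data.Product using (Σ; _×_; ∃)
open import Data.Sum using (_⊎_)
open import Relation.Nullary using (¬_)
open import Relation.Binary.PropositionalEquality using (_≡_)

record Matroid (n : ℕ) : Set where
  field
    rank       : Subset n → ℕ
    rank-≤-card : ∀ X → rank X ≤ ∣ X ∣
    rank-mono  : ∀ {X Y} → X ⊆ Y → rank X ≤ rank Y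
    rank-submod : ∀ X Y → rank (X ∪ Y) + rank (X ∩ Y) ≤ rank X + rank Y
open Matroid public

module _ {n : ℕ} (M : Matroid n) where

  Independent : Subset n → Set
  Independent X = rank M X ≡ ∣ X ∣

  Circuit : Subset n → Set
  Circuit C = ¬ Independent C × (∀ Y → Y ⊂ C → Independent Y)

  Flat : Subset n → Set
  Flat X = ∀ e → rank M (X ∪ ⁅ e ⁆) ≡ rank M X → e ∈ X

  Cyclic : Subset n → Set
  Cyclic X = Σ (List (Subset n)) λ Cs → All Circuit Cs × foldr _∪_ ⊥ Cs ≡ X

  CyclicFlat : Subset n → Set
  CyclicFlat X = Flat X × Cyclic X

  Incomparable : Subset n → Subset n → Set
  Incomparable X Y = ¬ X ⊆ Y × ¬ Y ⊆ X

  CyclicFlatAntichain : List (Subset n) → Set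
  CyclicFlatAntichain L = All CyclicFlat L × AllPairs Incomparable L

  Isthmus : Fin n → Set
  Isthmus e = rank M (∁ ⁅ e ⁆) < rank M ⊤

  Loop : Fin n → Set
  Loop e = rank M ⁅ e ⁆ ≡ 0

CW : ℕ → {n : ℕ} → Matroid n → Set
CW k {n} M = ∀ (L : List (Subset n)) → CyclicFlatAntichain M L → length L ≤ k

-- N is the dual of M:  r*(X) = |X| - r(E) + r(E \ X)
IsDual : {n : ℕ} → Matroid n → Matroid n → Set
IsDual M N = ∀ X → rank N X + rank M ⊤ ≡ ∣ X ∣ + rank M (∁ X)

-- single-element deletion M \ e  (remaining elements relabelled in order)
IsDeletion : {n : ℕ} → Fin (suc n) → Matroid n → Matroid (suc n) → Set
IsDeletion e M' M = ∀ X → rank M' X ≡ rank M (insertAt X e false)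

-- single-element contraction M / e :  r(X) = r_M(X ∪ e) - r_M(e)
IsContraction : {n : ℕ} → Fin (suc n) → Matroid n → Matroid (suc n) → Set
IsContraction e M' M = ∀ X → rank M' X + rank M ⁅ e ⁆ ≡ rank M (insertAt X e true)

data IsMinor : {m n : ℕ} → Matroid m → Matroid n → Set where
  same : ∀ {n} {N M : Matroid n} → (∀ X → rank N X ≡ rank M X) → IsMinor N M
  del  : ∀ {m n} {N : Matroid m} {M' : Matroid n} {M : Matroid (suc n)} (e : Fin (suc n)) →
         IsDeletion e M' M → IsMinor N M' → IsMinor N M
  con  : ∀ {m n} {N : Matroid m} {M' : Matroid n} {M : Matroid (suc n)} (e : Fin (suc n)) →
         IsContraction e M' M → IsMinor N M' → IsMinor N M

-- membership in the family Z of the free product, for the set A ∪ B (A ⊆ E(M), B ⊆ E(N))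
InZ : {m n : ℕ} → Matroid m → Matroid n → Subset m → Subset n → Set
InZ M N A B =
    (CyclicFlat M A × ¬ A ≡ ⊤ × B ≡ ⊥)
  ⊎ (A ≡ ⊤ × CyclicFlat N B × ¬ B ≡ ⊥)
  ⊎ (A ≡ ⊤ × B ≡ ⊥ × (∀ e → ¬ Isthmus M e) × (∀ f → ¬ Loop N f))

-- P is the free product M □ N on E(M) ∪ E(N) = Fin (m + n) (elements of M first):
-- its cyclic flats are exactly the sets of Z, with the prescribed ranks.
IsFreeProduct : {m n : ℕ} → Matroid m → Matroid n → Matroid (m + n) → Set
IsFreeProduct M N P =
    (∀ A B → CyclicFlat P (A ++ B) → InZ M N A B)
  × (∀ A B → InZ M N A B → CyclicFlat P (A ++ B))
  × (∀ A → InZ M N A ⊥ → rank P (A ++ ⊥) ≡ rank M A)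
  × (∀ B → InZ M N ⊤ B → rank P (⊤ ++ B) ≡ rank M ⊤ + rank N B)

{-# OPTIONS --safe #-}
-- Each of the three operations comes with a map from the cyclic flats of the new matroid
-- to the cyclic flats of a matroid of cyclic width at most k which keeps incomparable
-- sets incomparable, so antichains go to antichains of the same length.  Cyclic flats
-- are recognised pointwise: X is a cyclic flat iff every element spanned by X lies in X
-- and no element of X is a coloop of X.
-- For the dual the map is X ↦ E − X, as the dual rank formula exchanges the two
-- pointwise conditions.  For deleting or contracting e it is X ↦ cl(X) ∩ (X ∪ e) in M.
-- In a free product M □ N every cyclic flat lies inside E(M) or contains it, so an
-- antichain lies entirely on one side, and restriction to E(M), resp. E(N), maps it
-- into Z(M), resp. Z(N).
module Submission where

open import Defs
open import Data.Bool using (Bool; true; false)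
open import Data.Bool.Properties using (∨-identityʳ)
open import Data.Empty using (⊥-elim)
open import Data.Fin as Fin using (Fin; zero; suc; punchIn; punchOut)
open import Data.Fin.Properties using (punchIn-punchOut; punchInᵢ≢i; any?)
open import Data.Fin.Subset
open import Data.Fin.Subset.Induction using (⊂-wellFounded; Acc; acc)
open import Data.Fin.Subset.Properties
open import Data.List using (List; []; _∷_; allFin; map; length)
open import Data.List.Membership.Propositional using () renaming (_∈_ to _∈ˡ_)
open import Data.List.Membership.Propositional.Properties using (∈-allFin)
open import Data.List.Properties using (length-map)
open import Data.List.Relation.Unary.All as All using (All; []; _∷_)
open import Data.List.Relation.Unary.All.Properties using (map⁺)
open import Data.List.Relation.Unary.AllPairs using (AllPairs; []; _∷_)
open import Data.List.Relation.Unary.Any using (here; there)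
open import Data.Nat using (ℕ; suc; _+_; _≤_; _<_)
open import Data.Nat.Properties
open import Data.Nat.Tactic.RingSolver using (solve-∀)
open import Data.Product using (∃-syntax; _×_; _,_; proj₁; proj₂)
open import Data.Sum as Sum using (_⊎_; inj₁; inj₂; [_,_]′)
open import Data.Vec using (_∷_; []; insertAt; _++_; take; drop; here; there)
open import Data.Vec.Properties
  using (insertAt-lookup; insertAt-punchIn; []=⇒lookup; lookup⇒[]=; take++drop≡id)
open import Function using (_∘_; id)
open import Relation.Binary.PropositionalEquality
open import Relation.Nullary using (¬_; Dec; yes; no; ⌊_⌋; contradiction; ¬?; _×-dec_)

private variable
  k m n : ℕ
  p p′ q q′ r : Subset n
  x y : Fin n
  b c : Bool

-- Subsets

x∈p─q⇒x∉q : x ∈ p ─ q → x ∉ q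
x∈p─q⇒x∉q {x = zero}  {p = _ ∷ _} {q = inside ∷ _}  ()
x∈p─q⇒x∉q {x = zero}  {p = _ ∷ _} {q = outside ∷ _} _ ()
x∈p─q⇒x∉q {x = suc x} {p = _ ∷ _} {q = _ ∷ _} (there x∈p─q) (there x∈q) = x∈p─q⇒x∉q x∈p─q x∈q

x∈p-y⇒x≢y : x ∈ p - y → x ≢ y
x∈p-y⇒x≢y x∈p-y refl = x∈p─q⇒x∉q x∈p-y (x∈⁅x⁆ _)

─-monoˡ-⊆ : p ⊆ q → p ─ r ⊆ q ─ r
─-monoˡ-⊆ {p = p} {r = r} p⊆q x∈p─r = x∈p∧x∉q⇒x∈p─q (p⊆q (p─q⊆p p r x∈p─r)) (x∈p─q⇒x∉q x∈p─r)

∪-monoˡ-⊆ : p ⊆ q → p ∪ r ⊆ q ∪ r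
∪-monoˡ-⊆ {p = p} {r = r} p⊆q x∈p∪r = x∈p∪q⁺ (Sum.map₁ p⊆q (x∈p∪q⁻ p r x∈p∪r))

p⊆p-x∪q : x ∈ q → p ⊆ (p - x) ∪ q
p⊆p-x∪q {x = x} x∈q {y} y∈p with y Fin.≟ x
... | yes refl = x∈p∪q⁺ (inj₂ x∈q)
... | no y≢x  = x∈p∪q⁺ (inj₁ (x∈p∧x≢y⇒x∈p-y y∈p y≢x))

p∪q-x⊆p-x∪q : (p ∪ q) - x ⊆ (p - x) ∪ q
p∪q-x⊆p-x∪q {p = p} {q = q} {x = x} y∈ =
  x∈p∪q⁺ (Sum.map₁ (λ y∈p → x∈p∧x≢y⇒x∈p-y y∈p (x∈p-y⇒x≢y y∈)) (x∈p∪q⁻ p q (p─q⊆p _ _ y∈)))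

x∈p∪⁅y⁆∧x≢y⇒x∈p : x ∈ p ∪ ⁅ y ⁆ → x ≢ y → x ∈ p
x∈p∪⁅y⁆∧x≢y⇒x∈p {p = p} {y = y} x∈ x≢y =
  [ id , (λ x∈⁅y⁆ → contradiction (x∈⁅y⁆⇒x≡y y x∈⁅y⁆) x≢y) ]′ (x∈p∪q⁻ p ⁅ y ⁆ x∈)

1+∣p-x∣≡∣p∣ : x ∈ p → suc ∣ p - x ∣ ≡ ∣ p ∣
1+∣p-x∣≡∣p∣ {x = zero}  {p = inside ∷ p}  here       = cong (suc ∘ ∣_∣) (p─⊥≡p p)
1+∣p-x∣≡∣p∣ {x = suc x} {p = inside ∷ p}  (there x∈p) = cong suc (1+∣p-x∣≡∣p∣ x∈p)
1+∣p-x∣≡∣p∣ {x = suc x} {p = outside ∷ p} (there x∈p) = 1+∣p-x∣≡∣p∣ x∈p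

∣p∪⁅x⁆∣≡1+∣p∣ : x ∉ p → ∣ p ∪ ⁅ x ⁆ ∣ ≡ suc ∣ p ∣
∣p∪⁅x⁆∣≡1+∣p∣ {x = zero}  {p = inside ∷ p}  x∉p = contradiction here x∉p
∣p∪⁅x⁆∣≡1+∣p∣ {x = zero}  {p = outside ∷ p} _   = cong (suc ∘ ∣_∣) (∪-identityʳ p)
∣p∪⁅x⁆∣≡1+∣p∣ {x = suc x} {p = inside ∷ p}  x∉p = cong suc (∣p∪⁅x⁆∣≡1+∣p∣ (x∉p ∘ there))
∣p∪⁅x⁆∣≡1+∣p∣ {x = suc x} {p = outside ∷ p} x∉p = ∣p∪⁅x⁆∣≡1+∣p∣ (x∉p ∘ there)

∁[p∪q]≡∁p─q : ∀ (p q : Subset n) → ∁ (p ∪ q) ≡ ∁ p ─ q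
∁[p∪q]≡∁p─q []            []            = refl
∁[p∪q]≡∁p─q (inside ∷ p)  (inside ∷ q)  = cong (outside ∷_) (∁[p∪q]≡∁p─q p q)
∁[p∪q]≡∁p─q (inside ∷ p)  (outside ∷ q) = cong (outside ∷_) (∁[p∪q]≡∁p─q p q)
∁[p∪q]≡∁p─q (outside ∷ p) (inside ∷ q)  = cong (outside ∷_) (∁[p∪q]≡∁p─q p q)
∁[p∪q]≡∁p─q (outside ∷ p) (outside ∷ q) = cong (inside ∷_) (∁[p∪q]≡∁p─q p q)

∁[p─q]≡∁p∪q : ∀ (p q : Subset n) → ∁ (p ─ q) ≡ ∁ p ∪ q
∁[p─q]≡∁p∪q []            []            = refl
∁[p─q]≡∁p∪q (inside ∷ p)  (inside ∷ q)  = cong (inside ∷_) (∁[p─q]≡∁p∪q p q)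
∁[p─q]≡∁p∪q (outside ∷ p) (inside ∷ q)  = cong (inside ∷_) (∁[p─q]≡∁p∪q p q)
∁[p─q]≡∁p∪q (inside ∷ p)  (outside ∷ q) = cong (outside ∷_) (∁[p─q]≡∁p∪q p q)
∁[p─q]≡∁p∪q (outside ∷ p) (outside ∷ q) = cong (inside ∷_) (∁[p─q]≡∁p∪q p q)

⊤─p≡∁p : ∀ (p : Subset n) → ⊤ ─ p ≡ ∁ p
⊤─p≡∁p []            = refl
⊤─p≡∁p (inside ∷ p)  = cong (outside ∷_) (⊤─p≡∁p p)
⊤─p≡∁p (outside ∷ p) = cong (inside ∷_) (⊤─p≡∁p p)

module _ {P : Subset n → Set} where

  x∈⋃⁻ : ∀ {ps} → All P ps → x ∈ ⋃ ps → ∃[ p ] P p × x ∈ p × p ⊆ ⋃ ps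
  x∈⋃⁻ {ps = []}     []         x∈⊥   = contradiction x∈⊥ ∉⊥
  x∈⋃⁻ {ps = p ∷ ps} (Pp ∷ Pps) x∈p∪⋃ with x∈p∪q⁻ p (⋃ ps) x∈p∪⋃
  ... | inj₁ x∈p = p , Pp , x∈p , p⊆p∪q (⋃ ps)
  ... | inj₂ x∈⋃ = let q , Pq , x∈q , q⊆⋃ = x∈⋃⁻ Pps x∈⋃ in q , Pq , x∈q , q⊆p∪q p (⋃ ps) ∘ q⊆⋃

  ⋃-cover : (∀ {x} → x ∈ q → ∃[ p ] P p × x ∈ p × p ⊆ q) → ∃[ ps ] All P ps × ⋃ ps ≡ q
  ⋃-cover {q = q} cover with cover-from (allFin _)
    where
    cover-from : (xs : List (Fin n)) → ∃[ ps ] All P ps × ⋃ ps ⊆ q × (∀ {x} → x ∈ˡ xs → x ∈ q → x ∈ ⋃ ps)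
    cover-from []       = [] , [] , (λ x∈⊥ → contradiction x∈⊥ ∉⊥) , λ ()
    cover-from (x ∷ xs) with x ∈? q | cover-from xs
    ... | no x∉q | ps , Pps , ⋃⊆q , covered = ps , Pps , ⋃⊆q , λ where
      (here refl) x∈q → contradiction x∈q x∉q
      (there y∈xs)    → covered y∈xs
    ... | yes x∈q | ps , Pps , ⋃⊆q , covered =
      let p , Pp , x∈p , p⊆q = cover x∈q in
      p ∷ ps , Pp ∷ Pps , (λ y∈ → [ p⊆q , ⋃⊆q ]′ (x∈p∪q⁻ p (⋃ ps) y∈)) , λ where
        (here refl) _   → x∈p∪q⁺ (inj₁ x∈p)
        (there y∈xs) y∈q → x∈p∪q⁺ (inj₂ (covered y∈xs y∈q))
  ... | ps , Pps , ⋃⊆q , covered = ps , Pps , ⊆-antisym ⋃⊆q (covered (∈-allFin _))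

insertAt-∪-⁅⁆ : ∀ (p : Subset n) i b j → insertAt (p ∪ ⁅ j ⁆) i b ≡ insertAt p i b ∪ ⁅ punchIn i j ⁆
insertAt-∪-⁅⁆ p       zero    b j       = cong (_∷ _) (sym (∨-identityʳ b))
insertAt-∪-⁅⁆ (s ∷ p) (suc i) b zero    =
  cong (_ ∷_) (trans (cong (λ t → insertAt t i b) (∪-identityʳ p)) (sym (∪-identityʳ _)))
insertAt-∪-⁅⁆ (s ∷ p) (suc i) b (suc j) = cong (_ ∷_) (insertAt-∪-⁅⁆ p i b j)

insertAt-minus : ∀ (p : Subset n) i b j → insertAt (p - j) i b ≡ insertAt p i b - punchIn i j
insertAt-minus p       zero    b j       = refl
insertAt-minus (s ∷ p) (suc i) b zero    =
  cong (outside ∷_) (trans (cong (λ t → insertAt t i b) (p─⊥≡p p)) (sym (p─⊥≡p _)))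
insertAt-minus (s ∷ p) (suc i) b (suc j) = cong (s ∷_) (insertAt-minus p i b j)

insertAt-true : ∀ (p : Subset n) i → insertAt p i true ≡ insertAt p i false ∪ ⁅ i ⁆
insertAt-true p       zero    = cong (inside ∷_) (sym (∪-identityʳ p))
insertAt-true (s ∷ p) (suc i) = cong₂ _∷_ (sym (∨-identityʳ s)) (insertAt-true p i)

insertAt-true-minus : ∀ (p : Subset n) i → insertAt p i true - i ≡ insertAt p i false
insertAt-true-minus p       zero    = cong (outside ∷_) (p─⊥≡p p)
insertAt-true-minus (s ∷ p) (suc i) = cong (s ∷_) (insertAt-true-minus p i)

module _ {i : Fin (suc n)} where

  punchIn∈insertAt⁻ : ∀ {j} → punchIn i j ∈ insertAt p i b → j ∈ p
  punchIn∈insertAt⁻ {p = p} {b} {j} j∈ =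
    lookup⇒[]= j p (trans (sym (insertAt-punchIn p i b j)) ([]=⇒lookup j∈))

  punchIn∈insertAt⁺ : ∀ {j} → j ∈ p → punchIn i j ∈ insertAt p i b
  punchIn∈insertAt⁺ {p = p} {b} {j} j∈p =
    lookup⇒[]= (punchIn i j) _ (trans (insertAt-punchIn p i b j) ([]=⇒lookup j∈p))

  i∈insertAt-true : i ∈ insertAt p i true
  i∈insertAt-true {p = p} = lookup⇒[]= i _ (insertAt-lookup p i true)

  i∉insertAt-false : i ∉ insertAt p i false
  i∉insertAt-false {p = p} i∈ with trans (sym (insertAt-lookup p i false)) ([]=⇒lookup i∈)
  ... | ()

  insertAt-⊆⁻ : insertAt p i b ⊆ insertAt q i c → p ⊆ q
  insertAt-⊆⁻ sub j∈p = punchIn∈insertAt⁻ (sub (punchIn∈insertAt⁺ j∈p))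

punchIn-cases : ∀ {P : Fin (suc n) → Set} i → P i → (∀ j → P (punchIn i j)) → ∀ k → P k
punchIn-cases {P = P} i Pi Pj k with i Fin.≟ k
... | yes refl = Pi
... | no i≢k   = subst P (punchIn-punchOut i≢k) (Pj (punchOut i≢k))

++-⊆ : p ⊆ p′ → q ⊆ q′ → p ++ q ⊆ p′ ++ q′
++-⊆ {p = []}    {p′ = []}     _    q⊆q′ x∈q            = q⊆q′ x∈q
++-⊆ {p = _ ∷ _} {p′ = _ ∷ _} p⊆p′ _    {zero} here  with p⊆p′ here
... | here = here
++-⊆ {p = _ ∷ _} {p′ = _ ∷ _} p⊆p′ q⊆q′ {suc x} (there x∈) = there (++-⊆ (drop-∷-⊆ p⊆p′) q⊆q′ x∈)

-- Rank, circuits and cyclic flats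

module _ (M : Matroid n) where

  open ≤-Reasoning

  private variable
    C D I S T X Y U V : Subset n
    e : Fin n

  Spans : Subset n → Fin n → Set
  Spans X x = rank M (X ∪ ⁅ x ⁆) ≡ rank M X

  IsColoop : Subset n → Fin n → Set
  IsColoop X x = rank M (X - x) < rank M X

  CyclicFlatAt : Subset n → Fin n → Set
  CyclicFlatAt X x = (Spans X x → x ∈ X) × (x ∈ X → rank M (X - x) ≡ rank M X)

  rank-⊥ : rank M ⊥ ≡ 0
  rank-⊥ = n≤0⇒n≡0 (≤-trans (rank-≤-card M ⊥) (≤-reflexive (∣⊥∣≡0 n)))

  rank-minus-≤ : rank M (X - x) ≤ rank M X
  rank-minus-≤ = rank-mono M (p─q⊆p _ _)

  rank-∪-⁅⁆-≤ : rank M (X ∪ ⁅ x ⁆) ≤ suc (rank M X)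
  rank-∪-⁅⁆-≤ {X} {x} = begin
    rank M (X ∪ ⁅ x ⁆)                         ≤⟨ m≤m+n _ _ ⟩
    rank M (X ∪ ⁅ x ⁆) + rank M (X ∩ ⁅ x ⁆)    ≤⟨ rank-submod M X ⁅ x ⁆ ⟩
    rank M X + rank M ⁅ x ⁆                    ≤⟨ +-monoʳ-≤ _ (≤-trans (rank-≤-card M ⁅ x ⁆) (≤-reflexive (∣⁅x⁆∣≡1 x))) ⟩
    rank M X + 1                               ≡⟨ +-comm _ 1 ⟩
    suc (rank M X)                             ∎

  rank-≤-suc : Y ⊆ X ∪ ⁅ x ⁆ → rank M Y ≤ suc (rank M X)
  rank-≤-suc Y⊆ = ≤-trans (rank-mono M Y⊆) rank-∪-⁅⁆-≤

  ¬spans⇒rank-suc : ¬ Spans X x → rank M (X ∪ ⁅ x ⁆) ≡ suc (rank M X)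
  ¬spans⇒rank-suc ¬spans = ≤-antisym rank-∪-⁅⁆-≤ (≤∧≢⇒< (rank-mono M (p⊆p∪q _)) (¬spans ∘ sym))

  rank-submod-⊆ : U ⊆ X ∪ Y → V ⊆ X ∩ Y → rank M U + rank M V ≤ rank M X + rank M Y
  rank-submod-⊆ {X = X} {Y} U⊆ V⊆ = ≤-trans (+-mono-≤ (rank-mono M U⊆) (rank-mono M V⊆)) (rank-submod M X Y)

  rank-drop-antitone : T ⊆ S → x ∈ T → rank M S + rank M (T - x) ≤ rank M (S - x) + rank M T
  rank-drop-antitone T⊆S x∈T =
    rank-submod-⊆ (p⊆p-x∪q x∈T) (λ y∈ → x∈p∩q⁺ (─-monoˡ-⊆ T⊆S y∈ , p─q⊆p _ _ y∈))

  isColoop-⊆ : T ⊆ S → x ∈ T → IsColoop S x → IsColoop T x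
  isColoop-⊆ {T} {S} {x} T⊆S x∈T S-coloop = +-cancelˡ-≤ (rank M (S - x)) _ _ (begin
    rank M (S - x) + suc (rank M (T - x))  ≡⟨ +-suc _ _ ⟩
    suc (rank M (S - x)) + rank M (T - x)  ≤⟨ +-monoˡ-≤ _ S-coloop ⟩
    rank M S + rank M (T - x)              ≤⟨ rank-drop-antitone T⊆S x∈T ⟩
    rank M (S - x) + rank M T              ∎)

  spans-mono : X ⊆ Y → Spans X x → Spans Y x
  spans-mono {X} {Y} {x} X⊆Y X-spans = ≤-antisym (+-cancelʳ-≤ (rank M X) _ _ (begin
    rank M (Y ∪ ⁅ x ⁆) + rank M X   ≤⟨ rank-submod-⊆ Y∪x⊆ X⊆ ⟩
    rank M Y + rank M (X ∪ ⁅ x ⁆)   ≡⟨ cong (rank M Y +_) X-spans ⟩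
    rank M Y + rank M X             ∎)) (rank-mono M (p⊆p∪q _))
    where
    Y∪x⊆ : Y ∪ ⁅ x ⁆ ⊆ Y ∪ (X ∪ ⁅ x ⁆)
    Y∪x⊆ y∈ = x∈p∪q⁺ (Sum.map₂ (q⊆p∪q X ⁅ x ⁆) (x∈p∪q⁻ Y ⁅ x ⁆ y∈))
    X⊆ : X ⊆ Y ∩ (X ∪ ⁅ x ⁆)
    X⊆ y∈X = x∈p∩q⁺ (X⊆Y y∈X , p⊆p∪q _ y∈X)

  independent⇒isColoop : Independent M I → x ∈ I → IsColoop I x
  independent⇒isColoop {I} {x} I-indep x∈I = begin-strict
    rank M (I - x) ≤⟨ rank-≤-card M (I - x) ⟩
    ∣ I - x ∣      <⟨ x∈p⇒∣p-x∣<∣p∣ x∈I ⟩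
    ∣ I ∣          ≡⟨ sym I-indep ⟩
    rank M I       ∎

  independent-extend : x ∈ X → Independent M (X - x) → IsColoop X x → Independent M X
  independent-extend {x} {X} x∈X X-x-indep x-coloop = ≤-antisym (rank-≤-card M X) (begin
    ∣ X ∣                 ≡⟨ sym (1+∣p-x∣≡∣p∣ x∈X) ⟩
    suc ∣ X - x ∣         ≡⟨ cong suc (sym X-x-indep) ⟩
    suc (rank M (X - x))  ≤⟨ x-coloop ⟩
    rank M X              ∎)

  coloops⇒independent : (∀ {x} → x ∈ S → IsColoop S x) → Independent M S
  coloops⇒independent {S} = go (⊂-wellFounded S)
    where
    go : ∀ {S} → Acc _⊂_ S → (∀ {x} → x ∈ S → IsColoop S x) → Independent M S
    go {S} (acc rec) coloops with nonempty? S
    ... | no S-empty rewrite Empty-unique S-empty = trans rank-⊥ (sym (∣⊥∣≡0 n))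
    ... | yes (x , x∈S) = independent-extend x∈S
      (go (rec (x∈p⇒p-x⊂p x∈S)) (λ y∈ → isColoop-⊆ (p─q⊆p _ _) y∈ (coloops (p─q⊆p _ _ y∈))))
      (coloops x∈S)

  independent-⊆ : Independent M I → Y ⊆ I → Independent M Y
  independent-⊆ I-indep Y⊆I =
    coloops⇒independent (λ y∈Y → isColoop-⊆ Y⊆I y∈Y (independent⇒isColoop I-indep (Y⊆I y∈Y)))

  circuit⇒rank-minus≡ : Circuit M C → x ∈ C → C ⊆ X → rank M (X - x) ≡ rank M X
  circuit⇒rank-minus≡ {C} {x} {X} (dependent , minimal) x∈C C⊆X =
    ≤-antisym rank-minus-≤ (+-cancelʳ-≤ (rank M (C - x)) _ _ (begin
      rank M X + rank M (C - x)        ≤⟨ rank-drop-antitone C⊆X x∈C ⟩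
      rank M (X - x) + rank M C        ≤⟨ +-monoʳ-≤ _ (≤-pred rank-C<) ⟩
      rank M (X - x) + rank M (C - x)  ∎))
    where
    rank-C< : rank M C < suc (rank M (C - x))
    rank-C< = begin-strict
      rank M C              <⟨ ≤∧≢⇒< (rank-≤-card M C) dependent ⟩
      ∣ C ∣                 ≡⟨ sym (1+∣p-x∣≡∣p∣ x∈C) ⟩
      suc ∣ C - x ∣         ≡⟨ cong suc (sym (minimal (C - x) (x∈p⇒p-x⊂p x∈C))) ⟩
      suc (rank M (C - x))  ∎

  circuit-by-coloops : e ∈ D → rank M (D - e) ≡ rank M D →
                       (∀ {f} → f ∈ D → f ≢ e → IsColoop (D - f) e) → Circuit M D
  circuit-by-coloops {e} {D} e∈D D-e≡D coloop = dependent , λ _ → independent-⊂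
    where
    D-e-indep : Independent M (D - e)
    D-e-indep = coloops⇒independent λ {f} f∈D-e → begin-strict
      rank M (D - e - f)  ≡⟨ cong (rank M) (p─x─y≡p─y─x D e f) ⟩
      rank M (D - f - e)  <⟨ coloop (p─q⊆p _ _ f∈D-e) (x∈p-y⇒x≢y f∈D-e) ⟩
      rank M (D - f)      ≤⟨ rank-minus-≤ ⟩
      rank M D            ≡⟨ sym D-e≡D ⟩
      rank M (D - e)      ∎

    dependent : ¬ Independent M D
    dependent D-indep = 1+n≢n (begin-equality
      suc ∣ D - e ∣   ≡⟨ 1+∣p-x∣≡∣p∣ e∈D ⟩
      ∣ D ∣           ≡⟨ sym D-indep ⟩
      rank M D        ≡⟨ sym D-e≡D ⟩
      rank M (D - e)  ≡⟨ D-e-indep ⟩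
      ∣ D - e ∣       ∎)

    D-f-indep : ∀ {f} → f ∈ D → Independent M (D - f)
    D-f-indep {f} f∈D with f Fin.≟ e
    ... | yes refl = D-e-indep
    ... | no f≢e   = independent-extend (x∈p∧x≢y⇒x∈p-y e∈D (f≢e ∘ sym))
      (independent-⊆ D-e-indep (─-monoˡ-⊆ (p─q⊆p D ⁅ f ⁆))) (coloop f∈D f≢e)

    independent-⊂ : ∀ {Y} → Y ⊂ D → Independent M Y
    independent-⊂ (Y⊆D , f , f∈D , f∉Y) =
      independent-⊆ (D-f-indep f∈D) (λ y∈Y → x∈p∧x≢y⇒x∈p-y (Y⊆D y∈Y) (λ { refl → f∉Y y∈Y }))

  -- Remove elements f ≠ e from D while e stays spanned by the rest; where no f can be
  -- removed, D is a circuit.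
  ∃-circuit : e ∈ D → rank M (D - e) ≡ rank M D → ∃[ C ] Circuit M C × e ∈ C × C ⊆ D
  ∃-circuit {D = D} = go (⊂-wellFounded D)
    where
    go : ∀ {D} → Acc _⊂_ D → e ∈ D → rank M (D - e) ≡ rank M D → ∃[ C ] Circuit M C × e ∈ C × C ⊆ D
    go {e} {D} (acc rec) e∈D D-e≡D
      with any? (λ f → f ∈? D ×-dec ¬? (f Fin.≟ e) ×-dec rank M (D - f - e) ≟ rank M (D - f))
    ... | yes (f , f∈D , f≢e , D-f-e≡D-f) =
      let C , circuit , e∈C , C⊆D-f = go (rec (x∈p⇒p-x⊂p f∈D)) (x∈p∧x≢y⇒x∈p-y e∈D (f≢e ∘ sym)) D-f-e≡D-f
      in C , circuit , e∈C , λ x∈C → p─q⊆p D ⁅ f ⁆ (C⊆D-f x∈C)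
    ... | no ∄f = D , circuit-by-coloops e∈D D-e≡D coloop , e∈D , id
      where
      coloop : ∀ {f} → f ∈ D → f ≢ e → IsColoop (D - f) e
      coloop f∈D f≢e = ≤∧≢⇒< rank-minus-≤ (λ eq → ∄f (_ , f∈D , f≢e , eq))

  cyclic⇒rank-minus≡ : Cyclic M X → x ∈ X → rank M (X - x) ≡ rank M X
  cyclic⇒rank-minus≡ {X} (Cs , circuits , ⋃Cs≡X) x∈X
    with x∈⋃⁻ circuits (subst (_ ∈_) (sym ⋃Cs≡X) x∈X)
  ... | C , circuit , x∈C , C⊆⋃Cs = circuit⇒rank-minus≡ circuit x∈C (subst (_ ∈_) ⋃Cs≡X ∘ C⊆⋃Cs)

  rank-minus≡⇒cyclic : (∀ {x} → x ∈ X → rank M (X - x) ≡ rank M X) → Cyclic M X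
  rank-minus≡⇒cyclic noColoop = ⋃-cover (λ x∈X → ∃-circuit x∈X (noColoop x∈X))

  cyclicFlat⁺ : (∀ x → CyclicFlatAt X x) → CyclicFlat M X
  cyclicFlat⁺ local = proj₁ ∘ local , rank-minus≡⇒cyclic (proj₂ (local _))

  cyclicFlat⁻ : CyclicFlat M X → ∀ x → CyclicFlatAt X x
  cyclicFlat⁻ (flat , cyclic) x = flat x , cyclic⇒rank-minus≡ cyclic

  cyclicFlatAt-∪-spanned : y ≢ e → Spans X e → CyclicFlatAt X y → CyclicFlatAt (X ∪ ⁅ e ⁆) y
  cyclicFlatAt-∪-spanned {y} {e} {X} y≢e X-spans-e (closed , noColoop) = closed′ , noColoop′
    where
    closed′ : Spans (X ∪ ⁅ e ⁆) y → y ∈ X ∪ ⁅ e ⁆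
    closed′ X∪e-spans-y = p⊆p∪q _ (closed (≤-antisym (begin
      rank M (X ∪ ⁅ y ⁆)            ≤⟨ rank-mono M (∪-monoˡ-⊆ (p⊆p∪q _)) ⟩
      rank M ((X ∪ ⁅ e ⁆) ∪ ⁅ y ⁆)  ≡⟨ X∪e-spans-y ⟩
      rank M (X ∪ ⁅ e ⁆)            ≡⟨ X-spans-e ⟩
      rank M X                      ∎) (rank-mono M (p⊆p∪q _))))

    noColoop′ : y ∈ X ∪ ⁅ e ⁆ → rank M ((X ∪ ⁅ e ⁆) - y) ≡ rank M (X ∪ ⁅ e ⁆)
    noColoop′ y∈ = ≤-antisym rank-minus-≤ (begin
      rank M (X ∪ ⁅ e ⁆)          ≡⟨ X-spans-e ⟩
      rank M X                    ≡⟨ sym (noColoop (x∈p∪⁅y⁆∧x≢y⇒x∈p y∈ y≢e)) ⟩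
      rank M (X - y)              ≤⟨ rank-mono M (─-monoˡ-⊆ (p⊆p∪q _)) ⟩
      rank M ((X ∪ ⁅ e ⁆) - y)    ∎)

  cyclicFlatAt-∪-unspanned : y ≢ e → ¬ Spans X e → CyclicFlatAt (X ∪ ⁅ e ⁆) y → CyclicFlatAt X y
  cyclicFlatAt-∪-unspanned {y} {e} {X} y≢e ¬X-spans-e (closed , noColoop) = closed′ , noColoop′
    where
    closed′ : Spans X y → y ∈ X
    closed′ X-spans-y = x∈p∪⁅y⁆∧x≢y⇒x∈p (closed (spans-mono (p⊆p∪q _) X-spans-y)) y≢e

    noColoop′ : y ∈ X → rank M (X - y) ≡ rank M X
    noColoop′ y∈X = ≤-antisym rank-minus-≤ (≤-pred (begin
      suc (rank M X)              ≡⟨ sym (¬spans⇒rank-suc ¬X-spans-e) ⟩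
      rank M (X ∪ ⁅ e ⁆)          ≡⟨ sym (noColoop (p⊆p∪q _ y∈X)) ⟩
      rank M ((X ∪ ⁅ e ⁆) - y)    ≤⟨ rank-≤-suc p∪q-x⊆p-x∪q ⟩
      suc (rank M (X - y))        ∎))

  ⊤-cyclicFlat : (∀ e → ¬ Isthmus M e) → CyclicFlat M ⊤
  ⊤-cyclicFlat noIsthmus = cyclicFlat⁺ λ x → (λ _ → ∈⊤) , λ _ → ≤-antisym rank-minus-≤ (begin
    rank M ⊤            ≤⟨ ≮⇒≥ (noIsthmus x) ⟩
    rank M (∁ ⁅ x ⁆)    ≡⟨ cong (rank M) (sym (⊤─p≡∁p ⁅ x ⁆)) ⟩
    rank M (⊤ - x)      ∎)

  ⊥-cyclicFlat : (∀ e → ¬ Loop M e) → CyclicFlat M ⊥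
  ⊥-cyclicFlat noLoop = flat , [] , [] , refl
    where
    flat : Flat M ⊥
    flat x ⊥-spans-x =
      contradiction (trans (cong (rank M) (sym (∪-identityˡ ⁅ x ⁆))) (trans ⊥-spans-x rank-⊥)) (noLoop x)

-- Transporting antichains

module _ (M : Matroid m) (M′ : Matroid n) {Q : Subset m → Set} (g : Subset m → Subset n)
         (g-cyclicFlat : ∀ {Z} → Q Z → CyclicFlat M′ (g Z))
         (g-incomparable : ∀ {Z W} → Q Z → Q W → Incomparable M Z W → Incomparable M′ (g Z) (g W))
         where

  map-antichain : ∀ {L} → All Q L → AllPairs (Incomparable M) L → CyclicFlatAntichain M′ (map g L)
  map-antichain []         []                   = [] , []
  map-antichain (QZ ∷ QL) (Z-incomp ∷ L-incomp) =
    let cfs , pairs = map-antichain QL L-incomp in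
    g-cyclicFlat QZ ∷ cfs ,
    map⁺ (All.zipWith (λ (QW , incomp) → g-incomparable QZ QW incomp) (QL , Z-incomp)) ∷ pairs

  length-≤-width : CW k M′ → ∀ {L} → All Q L → AllPairs (Incomparable M) L → length L ≤ k
  length-≤-width {k} cw {L} QL pairs = subst (_≤ k) (length-map g L) (cw (map g L) (map-antichain QL pairs))

-- Duality

module _ (M N : Matroid n) (dual : IsDual M N) where

  open ≡-Reasoning

  private
    subtract-equations : ∀ {u u′ E} a a′ s → a + E ≡ s + u → a′ + E ≡ suc s + u′ → a′ + u ≡ suc a + u′
    subtract-equations {u} {u′} {E} a a′ s a+E≡s+u a′+E≡1+s+u′ = +-cancelʳ-≡ (s + E) _ _ (begin
      (a′ + u) + (s + E)       ≡⟨ shuffle a′ u s E ⟩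
      (a′ + E) + (s + u)       ≡⟨ cong₂ _+_ a′+E≡1+s+u′ (sym a+E≡s+u) ⟩
      (suc s + u′) + (a + E)   ≡⟨ reshuffle s u′ a E ⟩
      (suc a + u′) + (s + E)   ∎)
      where
      shuffle : ∀ a′ u s E → (a′ + u) + (s + E) ≡ (a′ + E) + (s + u)
      shuffle = solve-∀
      reshuffle : ∀ s u′ a E → (suc s + u′) + (a + E) ≡ (suc a + u′) + (s + E)
      reshuffle = solve-∀

  dual-rank-∪ : ∀ {X x} → x ∉ X → rank N (X ∪ ⁅ x ⁆) + rank M (∁ X) ≡ suc (rank N X) + rank M (∁ X - x)
  dual-rank-∪ {X} {x} x∉X = subtract-equations (rank N X) (rank N (X ∪ ⁅ x ⁆)) ∣ X ∣ (dual X) (begin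
    rank N (X ∪ ⁅ x ⁆) + rank M ⊤          ≡⟨ dual (X ∪ ⁅ x ⁆) ⟩
    ∣ X ∪ ⁅ x ⁆ ∣ + rank M (∁ (X ∪ ⁅ x ⁆))  ≡⟨ cong₂ _+_ (∣p∪⁅x⁆∣≡1+∣p∣ x∉X) (cong (rank M) (∁[p∪q]≡∁p─q X ⁅ x ⁆)) ⟩
    suc ∣ X ∣ + rank M (∁ X - x)            ∎)

  dual-rank-minus : ∀ {X x} → x ∈ X → rank N X + rank M (∁ X ∪ ⁅ x ⁆) ≡ suc (rank N (X - x)) + rank M (∁ X)
  dual-rank-minus {X} {x} x∈X = subtract-equations (rank N (X - x)) (rank N X) ∣ X - x ∣ (begin
    rank N (X - x) + rank M ⊤          ≡⟨ dual (X - x) ⟩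
    ∣ X - x ∣ + rank M (∁ (X - x))     ≡⟨ cong (∣ X - x ∣ +_) (cong (rank M) (∁[p─q]≡∁p∪q X ⁅ x ⁆)) ⟩
    ∣ X - x ∣ + rank M (∁ X ∪ ⁅ x ⁆)   ∎) (begin
    rank N X + rank M ⊤                ≡⟨ dual X ⟩
    ∣ X ∣ + rank M (∁ X)               ≡⟨ cong (_+ rank M (∁ X)) (sym (1+∣p-x∣≡∣p∣ x∈X)) ⟩
    suc ∣ X - x ∣ + rank M (∁ X)       ∎)

  dual-cyclicFlatAt : ∀ {X x} → CyclicFlatAt N X x → CyclicFlatAt M (∁ X) x
  dual-cyclicFlatAt {X} {x} (closed , noColoop) = closed′ , noColoop′
    where
    closed′ : Spans M (∁ X) x → x ∈ ∁ X
    closed′ ∁X-spans-x with x ∈? X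
    ... | no x∉X  = x∉p⇒x∈∁p x∉X
    ... | yes x∈X = contradiction (+-cancelʳ-≡ (rank M (∁ X)) _ _ (begin
      rank N X + rank M (∁ X)              ≡⟨ cong (rank N X +_) (sym ∁X-spans-x) ⟩
      rank N X + rank M (∁ X ∪ ⁅ x ⁆)      ≡⟨ dual-rank-minus x∈X ⟩
      suc (rank N (X - x)) + rank M (∁ X)  ≡⟨ cong (λ t → suc t + rank M (∁ X)) (noColoop x∈X) ⟩
      suc (rank N X) + rank M (∁ X)        ∎)) (1+n≢n ∘ sym)

    noColoop′ : x ∈ ∁ X → rank M (∁ X - x) ≡ rank M (∁ X)
    noColoop′ x∈∁X = sym (+-cancelˡ-≡ (suc (rank N X)) _ _ (begin
      suc (rank N X) + rank M (∁ X)        ≡⟨ cong (_+ rank M (∁ X)) (sym (¬spans⇒rank-suc N (x∉X ∘ closed))) ⟩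
      rank N (X ∪ ⁅ x ⁆) + rank M (∁ X)    ≡⟨ dual-rank-∪ x∉X ⟩
      suc (rank N X) + rank M (∁ X - x)    ∎))
      where x∉X = x∈∁p⇒x∉p x∈∁X

  dual-cyclicFlat : ∀ {X} → CyclicFlat N X → CyclicFlat M (∁ X)
  dual-cyclicFlat cf = cyclicFlat⁺ M (dual-cyclicFlatAt ∘ cyclicFlat⁻ N cf)

  dual-CW : CW k M → CW k N
  dual-CW cw _ (cfs , pairs) = length-≤-width N M ∁ dual-cyclicFlat
    (λ _ _ (Z⊈W , W⊈Z) → W⊈Z ∘ ∁p⊆∁q⇒p⊇q , Z⊈W ∘ ∁p⊆∁q⇒p⊇q) cw cfs pairs

-- Minors

-- Deletion of e is the case b = false, c = 0; contraction is b = true, c = r {e}.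
IsElementMinor : Fin (suc n) → Bool → ℕ → Matroid n → Matroid (suc n) → Set
IsElementMinor e b c M′ M = ∀ X → rank M′ X + c ≡ rank M (insertAt X e b)

module _ (e : Fin (suc n)) (M : Matroid (suc n)) where

  open ≡-Reasoning

  private
    _⟨_⟩ : Subset n → Bool → Subset (suc n)
    X ⟨ b ⟩ = insertAt X e b

  lift : Subset n → Subset (suc n)
  lift X = X ⟨ ⌊ rank M (X ⟨ false ⟩ ∪ ⁅ e ⁆) ≟ rank M (X ⟨ false ⟩) ⌋ ⟩

  cyclicFlatAt-true : ∀ {X x} → Spans M (X ⟨ false ⟩) e → ∀ b →
                      CyclicFlatAt M (X ⟨ b ⟩) (punchIn e x) → CyclicFlatAt M (X ⟨ true ⟩) (punchIn e x)
  cyclicFlatAt-true         spans true  = id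
  cyclicFlatAt-true {X} {x} spans false =
    subst (λ Y → CyclicFlatAt M Y (punchIn e x)) (sym (insertAt-true X e))
    ∘ cyclicFlatAt-∪-spanned M (punchInᵢ≢i e x) spans

  cyclicFlatAt-false : ∀ {X x} → ¬ Spans M (X ⟨ false ⟩) e → ∀ b →
                       CyclicFlatAt M (X ⟨ b ⟩) (punchIn e x) → CyclicFlatAt M (X ⟨ false ⟩) (punchIn e x)
  cyclicFlatAt-false         ¬spans false = id
  cyclicFlatAt-false {X} {x} ¬spans true  =
    cyclicFlatAt-∪-unspanned M (punchInᵢ≢i e x) ¬spans
    ∘ subst (λ Y → CyclicFlatAt M Y (punchIn e x)) (insertAt-true X e)

  module _ (M′ : Matroid n) (b : Bool) (c : ℕ) (minor : IsElementMinor e b c M′ M) where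

    minor-cyclicFlatAt : ∀ {X x} → CyclicFlatAt M′ X x → CyclicFlatAt M (X ⟨ b ⟩) (punchIn e x)
    minor-cyclicFlatAt {X} {x} (closed , noColoop) = closed′ , noColoop′
      where
      closed′ : Spans M (X ⟨ b ⟩) (punchIn e x) → punchIn e x ∈ X ⟨ b ⟩
      closed′ spans = punchIn∈insertAt⁺ (closed (+-cancelʳ-≡ c _ _ (begin
        rank M′ (X ∪ ⁅ x ⁆) + c             ≡⟨ minor (X ∪ ⁅ x ⁆) ⟩
        rank M ((X ∪ ⁅ x ⁆) ⟨ b ⟩)          ≡⟨ cong (rank M) (insertAt-∪-⁅⁆ X e b x) ⟩
        rank M (X ⟨ b ⟩ ∪ ⁅ punchIn e x ⁆)  ≡⟨ spans ⟩
        rank M (X ⟨ b ⟩)                    ≡⟨ minor X ⟨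
        rank M′ X + c                       ∎)))

      noColoop′ : punchIn e x ∈ X ⟨ b ⟩ → rank M (X ⟨ b ⟩ - punchIn e x) ≡ rank M (X ⟨ b ⟩)
      noColoop′ x∈ = begin
        rank M (X ⟨ b ⟩ - punchIn e x)  ≡⟨ cong (rank M) (insertAt-minus X e b x) ⟨
        rank M ((X - x) ⟨ b ⟩)          ≡⟨ minor (X - x) ⟨
        rank M′ (X - x) + c             ≡⟨ cong (_+ c) (noColoop (punchIn∈insertAt⁻ x∈)) ⟩
        rank M′ X + c                   ≡⟨ minor X ⟩
        rank M (X ⟨ b ⟩)                ∎

    lift-cyclicFlat : ∀ {X} → CyclicFlat M′ X → CyclicFlat M (lift X)
    lift-cyclicFlat {X} cf = lifted (rank M (X ⟨ false ⟩ ∪ ⁅ e ⁆) ≟ rank M (X ⟨ false ⟩))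
      where
      at-punchIn : ∀ x → CyclicFlatAt M (X ⟨ b ⟩) (punchIn e x)
      at-punchIn x = minor-cyclicFlatAt (cyclicFlat⁻ M′ cf x)

      lifted : (d : Dec (Spans M (X ⟨ false ⟩) e)) → CyclicFlat M (X ⟨ ⌊ d ⌋ ⟩)
      lifted (yes spans) = cyclicFlat⁺ M (punchIn-cases e
        ((λ _ → i∈insertAt-true) , λ _ → begin
          rank M (X ⟨ true ⟩ - e)          ≡⟨ cong (rank M) (insertAt-true-minus X e) ⟩
          rank M (X ⟨ false ⟩)             ≡⟨ spans ⟨
          rank M (X ⟨ false ⟩ ∪ ⁅ e ⁆)     ≡⟨ cong (rank M) (insertAt-true X e) ⟨
          rank M (X ⟨ true ⟩)              ∎)
        (λ x → cyclicFlatAt-true spans b (at-punchIn x)))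
      lifted (no ¬spans) = cyclicFlat⁺ M (punchIn-cases e
        ((λ spans → contradiction spans ¬spans) , λ e∈ → contradiction e∈ i∉insertAt-false)
        (λ x → cyclicFlatAt-false ¬spans b (at-punchIn x)))

    elementMinor-CW : CW k M → CW k M′
    elementMinor-CW cw _ (cfs , pairs) = length-≤-width M′ M lift lift-cyclicFlat
      (λ _ _ (Z⊈W , W⊈Z) → Z⊈W ∘ insertAt-⊆⁻ , W⊈Z ∘ insertAt-⊆⁻) cw cfs pairs

cyclicFlat-≗ : ∀ (N M : Matroid n) {X} → (∀ Y → rank N Y ≡ rank M Y) → CyclicFlat N X → CyclicFlat M X
cyclicFlat-≗ N M {X} ranks≡ cf = cyclicFlat⁺ M λ x →
  let closed , noColoop = cyclicFlat⁻ N cf x in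
  (λ spans → closed (trans (ranks≡ _) (trans spans (sym (ranks≡ X))))) ,
  (λ x∈X → trans (sym (ranks≡ _)) (trans (noColoop x∈X) (ranks≡ X)))

minor-CW : ∀ {N : Matroid m} {M : Matroid n} → IsMinor N M → CW k M → CW k N
minor-CW {N = N} {M} (same ranks≡) cw _ (cfs , pairs) =
  length-≤-width N M id (cyclicFlat-≗ N M ranks≡) (λ _ _ → id) cw cfs pairs
minor-CW (del {M' = M′} {M = M} e deletion minor) cw =
  minor-CW minor (elementMinor-CW e M M′ false 0 (λ X → trans (+-identityʳ _) (deletion X)) cw)
minor-CW (con {M' = M′} {M = M} e contraction minor) cw =
  minor-CW minor (elementMinor-CW e M M′ true (rank M ⁅ e ⁆) contraction cw)

-- Free products

split-⊆ : ∀ {Z W : Subset (m + n)} → take m Z ⊆ take m W → drop m Z ⊆ drop m W → Z ⊆ W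
split-⊆ {m} {Z = Z} {W} take⊆ drop⊆ = subst₂ _⊆_ (take++drop≡id m Z) (take++drop≡id m W) (++-⊆ take⊆ drop⊆)

take-reflects-⊆ : ∀ {Z W : Subset (m + n)} → drop m Z ≡ ⊥ → take m Z ⊆ take m W → Z ⊆ W
take-reflects-⊆ {m} {W = W} drop≡⊥ take⊆ = split-⊆ take⊆ (subst (_⊆ drop m W) (sym drop≡⊥) ⊥⊆)

drop-reflects-⊆ : ∀ {Z W : Subset (m + n)} → take m W ≡ ⊤ → drop m Z ⊆ drop m W → Z ⊆ W
drop-reflects-⊆ {m} {Z = Z} take≡⊤ drop⊆ = split-⊆ (subst (take m Z ⊆_) (sym take≡⊤) ⊆⊤) drop⊆

module _ (M : Matroid m) (N : Matroid n) (P : Matroid (m + n)) (fp : IsFreeProduct M N P) where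

  private variable
    Z W : Subset (m + n)

  cyclicFlat-inZ : CyclicFlat P Z → InZ M N (take m Z) (drop m Z)
  cyclicFlat-inZ {Z} cf = proj₁ fp (take m Z) (drop m Z) (subst (CyclicFlat P) (sym (take++drop≡id m Z)) cf)

  below-or-above : CyclicFlat P Z → drop m Z ≡ ⊥ ⊎ take m Z ≡ ⊤
  below-or-above cf with cyclicFlat-inZ cf
  ... | inj₁ (_ , _ , drop≡⊥)     = inj₁ drop≡⊥
  ... | inj₂ (inj₁ (take≡⊤ , _)) = inj₂ take≡⊤
  ... | inj₂ (inj₂ (take≡⊤ , _)) = inj₂ take≡⊤

  take-cyclicFlat : CyclicFlat P Z → drop m Z ≡ ⊥ → CyclicFlat M (take m Z)
  take-cyclicFlat cf drop≡⊥ with cyclicFlat-inZ cf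
  ... | inj₁ (cfM , _)                          = cfM
  ... | inj₂ (inj₁ (_ , _ , drop≢⊥))            = contradiction drop≡⊥ drop≢⊥
  ... | inj₂ (inj₂ (take≡⊤ , _ , noIsthmus , _)) = subst (CyclicFlat M) (sym take≡⊤) (⊤-cyclicFlat M noIsthmus)

  drop-cyclicFlat : CyclicFlat P Z → take m Z ≡ ⊤ → CyclicFlat N (drop m Z)
  drop-cyclicFlat cf take≡⊤ with cyclicFlat-inZ cf
  ... | inj₁ (_ , take≢⊤ , _)                   = contradiction take≡⊤ take≢⊤
  ... | inj₂ (inj₁ (_ , cfN , _))               = cfN
  ... | inj₂ (inj₂ (_ , drop≡⊥ , _ , noLoop))   = subst (CyclicFlat N) (sym drop≡⊥) (⊥-cyclicFlat N noLoop)

  Below Above : Subset (m + n) → Set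
  Below Z = CyclicFlat P Z × drop m Z ≡ ⊥
  Above Z = CyclicFlat P Z × take m Z ≡ ⊤

  below⊆above : drop m Z ≡ ⊥ → take m W ≡ ⊤ → Z ⊆ W
  below⊆above drop≡⊥ take≡⊤ = take-reflects-⊆ drop≡⊥ (subst (_ ⊆_) (sym take≡⊤) ⊆⊤)

  antichain-below-or-above : ∀ {L} → CyclicFlatAntichain P L → All Below L ⊎ All Above L
  antichain-below-or-above {[]}    _                          = inj₁ []
  antichain-below-or-above {Z ∷ L} (cfZ ∷ cfs , Z-incomp ∷ _) with below-or-above cfZ
  ... | inj₁ dropZ≡⊥ = inj₁ ((cfZ , dropZ≡⊥) ∷ All.zipWith below (cfs , Z-incomp))
    where
    below : ∀ {W} → CyclicFlat P W × Incomparable P Z W → Below W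
    below (cfW , Z⊈W , _) =
      cfW , [ id , (λ takeW≡⊤ → ⊥-elim (Z⊈W (below⊆above dropZ≡⊥ takeW≡⊤))) ]′ (below-or-above cfW)
  ... | inj₂ takeZ≡⊤ = inj₂ ((cfZ , takeZ≡⊤) ∷ All.zipWith above (cfs , Z-incomp))
    where
    above : ∀ {W} → CyclicFlat P W × Incomparable P Z W → Above W
    above (cfW , _ , W⊈Z) =
      cfW , [ (λ dropW≡⊥ → ⊥-elim (W⊈Z (below⊆above dropW≡⊥ takeZ≡⊤))) , id ]′ (below-or-above cfW)

  freeProduct-CW : CW k M → CW k N → CW k P
  freeProduct-CW cwM cwN L ac@(_ , pairs) with antichain-below-or-above ac
  ... | inj₁ below = length-≤-width P M (take m) (λ (cf , drop≡⊥) → take-cyclicFlat cf drop≡⊥)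
    (λ (_ , dropZ≡⊥) (_ , dropW≡⊥) (Z⊈W , W⊈Z) →
       Z⊈W ∘ take-reflects-⊆ dropZ≡⊥ , W⊈Z ∘ take-reflects-⊆ dropW≡⊥)
    cwM below pairs
  ... | inj₂ above = length-≤-width P N (drop m) (λ (cf , take≡⊤) → drop-cyclicFlat cf take≡⊤)
    (λ (_ , takeZ≡⊤) (_ , takeW≡⊤) (Z⊈W , W⊈Z) →
       Z⊈W ∘ drop-reflects-⊆ takeW≡⊤ , W⊈Z ∘ drop-reflects-⊆ takeZ≡⊤)
    cwN above pairs

theorem5p1 : (k : ℕ) → 1 ≤ k →
    (∀ {n} (M N : Matroid n) → IsDual M N → CW k M → CW k N)
  × (∀ {m n} (M : Matroid n) (N : Matroid m) → IsMinor N M → CW k M → CW k N)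
  × (∀ {m n} (M : Matroid m) (N : Matroid n) (P : Matroid (m + n)) →
       IsFreeProduct M N P → CW k M → CW k N → CW k P)
theorem5p1 k _ =
    (λ M N dual → dual-CW M N dual)
  , (λ _ _ minor → minor-CW minor)
  , (λ M N P freeProduct → freeProduct-CW M N P freeProduct)
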